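{- For every integer $n \geq 3$ there exists a simple hamiltonian graph on $n$ vertices such that: - its diameter is at most $2 \lfloor \log_2 n \rfloor$; - its maximum degree is at most $3$; - it has at most $\left\lfloor \frac{11n}{8} + \frac{3}{4} \right\rfloor$ edges.
   Context: A graph is hamiltonian if it contains a cycle (of length at least $3$) passing through every vertex exactly once. The diameter is the maximum, over all pairs of vertices, of the length of a shortest path between them. -}

module Defs where

open import Data.Nat using (ℕ; zero; suc; _+_; _≤_; _<ᵇ_; _∸_)
open import Data.Bool using (Bool; true; false; T; _∧_)
open import Data.Fin using (Fin; toℕ)
open import Data.List using (List; length; filterᵇ; allFin; concatMap; map)
open import Data.Product using (Σ; _×_; _,_; ∃-syntax)
open import Relation.Binary.PropositionalEquality using (_≡_)
open import Function.Definitions using (Injective)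

record Graph (n : ℕ) : Set where
  field
    adj    : Fin n → Fin n → Bool
    sym    : ∀ u v → adj u v ≡ adj v u
    irrefl : ∀ v → adj v v ≡ false

open Graph public

Adj : ∀ {n} → Graph n → Fin n → Fin n → Set
Adj G u v = T (adj G u v)

degree : ∀ {n} → Graph n → Fin n → ℕ
degree {n} G v = length (filterᵇ (adj G v) (allFin n))

edgePairs : ∀ {n} → Graph n → List (Fin n × Fin n)
edgePairs {n} G =
  filterᵇ (λ p → (toℕ (Data.Product.proj₁ p) <ᵇ toℕ (Data.Product.proj₂ p))
                  ∧ adj G (Data.Product.proj₁ p) (Data.Product.proj₂ p))
          (concatMap (λ u → map (λ v → (u , v)) (allFin n)) (allFin n))

numEdges : ∀ {n} → Graph n → ℕ
numEdges G = length (edgePairs G)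

MaxDegree≤ : ∀ {n} → Graph n → ℕ → Set
MaxDegree≤ G d = ∀ v → degree G v ≤ d

data Walk {n} (G : Graph n) : Fin n → Fin n → ℕ → Set where
  here : ∀ {v} → Walk G v v 0
  step : ∀ {u w v k} → Adj G u w → Walk G w v k → Walk G u v (suc k)

-- distance from u to v is at most d (a shortest walk is a path)
Dist≤ : ∀ {n} → Graph n → Fin n → Fin n → ℕ → Set
Dist≤ G u v d = ∃[ k ] (k ≤ d × Walk G u v k)

Diameter≤ : ∀ {n} → Graph n → ℕ → Set
Diameter≤ G d = ∀ u v → Dist≤ G u v d

-- hamiltonian: a cyclic ordering σ(0), …, σ(n-1) of all vertices (σ injective,
-- hence a bijection of Fin n) with consecutive vertices adjacent and
-- σ(n-1) adjacent to σ(0); together with 3 ≤ n this is a cycle of length ≥ 3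
-- through every vertex exactly once.
Hamiltonian : ∀ {n} → Graph n → Set
Hamiltonian {n} G = 3 ≤ n × (Σ (Fin n → Fin n) λ σ →
    Injective _≡_ _≡_ σ
  × (∀ i j → suc (toℕ i) ≡ toℕ j → Adj G (σ i) (σ j))
  × (∀ i j → toℕ i ≡ n ∸ 1 → toℕ j ≡ 0 → Adj G (σ i) (σ j)))

module Submission where

-- The graph is the cycle 0, 1, …, n − 1 plus a matching of chords, encoded by an involution of
-- {0, …, n − 1}; every vertex has degree at most 3, and X chords give n + X edges. The chords are
-- laid out recursively on segments of consecutive vertices. A chorded path of radius r has every
-- vertex within r steps of its first one, and exists on every L < 2 ^ (r + 1) vertices: it is a
-- shorter path behind a new root, a triangle, or a branch of radius r + 2, made of a root, a path
-- of radius r + 1, a reversed path of radius r, a hub joined to the root by a chord, and a path of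
-- radius r. By induction its X chords satisfy 8 X + 1 ≤ 3 L. For K = ⌊log₂ n⌋ the cycle is cut at
-- a hub with a chorded path of radius K − 1 on either side: every vertex lies within K of the hub,
-- so the diameter is at most 2 K, and there are at most n + 1 + 3 (n − 1) / 8 ≤ (11 n + 6) / 8 edges.

open import Data.Bool using (Bool; true; false; T; _∧_; _∨_; not; if_then_else_)
open import Data.Bool.Properties using (∧-identityʳ; ∧-zeroʳ; T-∧)
open import Data.Empty using (⊥-elim)
open import Data.Fin using (Fin; toℕ; fromℕ<)
open import Data.Fin.Properties using (toℕ-injective; toℕ<n; toℕ-fromℕ<)
open import Data.List using (List; []; _∷_; length; filterᵇ; allFin; concatMap; map; tabulate; _++_)
open import Data.List.Properties using (map-++; map-tabulate; map-∘; map-cong)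
open import Data.Nat
open import Data.Nat.DivMod using (m*n/n≡m; /-monoˡ-≤)
open import Data.Nat.ListAction using (sum)
open import Data.Nat.ListAction.Properties using (sum-++)
open import Data.Nat.Logarithm using (⌊log₂_⌋; ⌊log₂⌋-mono-≤; ⌊log₂[2^n]⌋≡n)
open import Data.Nat.Properties
open import Algebra.Properties.CommutativeSemigroup +-commutativeSemigroup using (interchange)
open import Data.Nat.Tactic.RingSolver using (solve-∀)
open import Data.Product using (Σ; _×_; _,_; ∃-syntax; proj₁; proj₂)
open import Data.Sum using (_⊎_; inj₁; inj₂)
import Data.Sum as Sum
open import Data.Unit using (tt)
open import Defs hiding (sym)
open import Function using (_∘_; id)
open import Function.Bundles using (Equivalence)
open import Relation.Binary.PropositionalEquality
open import Relation.Nullary using (¬_; yes; no)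

T⇒≡true : ∀ {b} → T b → b ≡ true
T⇒≡true {true} _ = refl

¬T⇒≡false : ∀ {b} → ¬ T b → b ≡ false
¬T⇒≡false {true}  ¬t = ⊥-elim (¬t tt)
¬T⇒≡false {false} _  = refl

T-extensional : ∀ {a b} → (T a → T b) → (T b → T a) → a ≡ b
T-extensional {true}  {true}  _ _ = refl
T-extensional {true}  {false} f _ = ⊥-elim (f tt)
T-extensional {false} {true}  _ g = ⊥-elim (g tt)
T-extensional {false} {false} _ _ = refl

∨-swap : ∀ a b c → (a ∨ (b ∨ c)) ≡ (b ∨ (a ∨ c))
∨-swap true  true  c = refl
∨-swap true  false c = refl
∨-swap false b     c = refl

T-not∧∨∨ : ∀ a b c d → ¬ T a → T b ⊎ T c ⊎ T d → T (not a ∧ (b ∨ (c ∨ d)))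
T-not∧∨∨ true  _     _     _     ¬a _ = ⊥-elim (¬a tt)
T-not∧∨∨ false true  _     _     _  _ = tt
T-not∧∨∨ false false true  _     _  _ = tt
T-not∧∨∨ false false false true  _  _ = tt
T-not∧∨∨ false false false false _ (inj₁ ())
T-not∧∨∨ false false false false _ (inj₂ (inj₁ ()))
T-not∧∨∨ false false false false _ (inj₂ (inj₂ ()))

T-not∧∨∨⁻ : ∀ a b c d → T (not a ∧ (b ∨ (c ∨ d))) → T b ⊎ T c ⊎ T d
T-not∧∨∨⁻ false true  _     _    _ = inj₁ tt
T-not∧∨∨⁻ false false true  _    _ = inj₂ (inj₁ tt)
T-not∧∨∨⁻ false false false true _ = inj₂ (inj₂ tt)

≡ᵇ-refl : ∀ m → (m ≡ᵇ m) ≡ true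
≡ᵇ-refl m = T⇒≡true (≡⇒≡ᵇ m m refl)

≢⇒≡ᵇ≡false : ∀ {m n} → m ≢ n → (m ≡ᵇ n) ≡ false
≢⇒≡ᵇ≡false {m} {n} m≢n = ¬T⇒≡false (m≢n ∘ ≡ᵇ⇒≡ m n)

≡ᵇ-comm : ∀ m n → (m ≡ᵇ n) ≡ (n ≡ᵇ m)
≡ᵇ-comm m n = T-extensional (≡⇒≡ᵇ n m ∘ sym ∘ ≡ᵇ⇒≡ m n) (≡⇒≡ᵇ m n ∘ sym ∘ ≡ᵇ⇒≡ n m)

<⇒<ᵇ≡true : ∀ {m n} → m < n → (m <ᵇ n) ≡ true
<⇒<ᵇ≡true = T⇒≡true ∘ <⇒<ᵇ

≮⇒<ᵇ≡false : ∀ {m n} → m ≮ n → (m <ᵇ n) ≡ false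
≮⇒<ᵇ≡false {m} {n} m≮n = ¬T⇒≡false (m≮n ∘ <ᵇ⇒< m n)

+-cancelˡ-<ᵇ : ∀ a i j → (a + i <ᵇ a + j) ≡ (i <ᵇ j)
+-cancelˡ-<ᵇ zero    i j = refl
+-cancelˡ-<ᵇ (suc a) i j = +-cancelˡ-<ᵇ a i j

𝟙 : Bool → ℕ
𝟙 true  = 1
𝟙 false = 0

𝟙≤1 : ∀ b → 𝟙 b ≤ 1
𝟙≤1 true  = ≤-refl
𝟙≤1 false = z≤n

𝟙-≤-⊎ : ∀ a b c d → (T a → T b ⊎ T c ⊎ T d) → 𝟙 a ≤ 𝟙 b + (𝟙 c + 𝟙 d)
𝟙-≤-⊎ false b     c     d    _ = z≤n
𝟙-≤-⊎ true  true  c     d    _ = s≤s z≤n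
𝟙-≤-⊎ true  false true  d    _ = s≤s z≤n
𝟙-≤-⊎ true  false false true _ = s≤s z≤n
𝟙-≤-⊎ true  false false false f with f tt
... | inj₁ ()
... | inj₂ (inj₁ ())
... | inj₂ (inj₂ ())

∑< : ℕ → (ℕ → ℕ) → ℕ
∑< zero    f = 0
∑< (suc L) f = f 0 + ∑< L (f ∘ suc)

syntax ∑< L (λ i → e) = ∑[ i < L ] e

∑-cong : ∀ L {f g : ℕ → ℕ} → (∀ i → i < L → f i ≡ g i) → ∑< L f ≡ ∑< L g
∑-cong zero    _  = refl
∑-cong (suc L) eq = cong₂ _+_ (eq 0 z<s) (∑-cong L (λ i i<L → eq (suc i) (s<s i<L)))

∑-mono-≤ : ∀ L {f g : ℕ → ℕ} → (∀ i → i < L → f i ≤ g i) → ∑< L f ≤ ∑< L g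
∑-mono-≤ zero    _  = z≤n
∑-mono-≤ (suc L) le = +-mono-≤ (le 0 z<s) (∑-mono-≤ L (λ i i<L → le (suc i) (s<s i<L)))

∑-zero : ∀ L → ∑[ _ < L ] 0 ≡ 0
∑-zero zero    = refl
∑-zero (suc L) = ∑-zero L

∑-distrib-+ : ∀ L (f g : ℕ → ℕ) → ∑[ i < L ] (f i + g i) ≡ ∑< L f + ∑< L g
∑-distrib-+ zero    f g = refl
∑-distrib-+ (suc L) f g =
  trans (cong (f 0 + g 0 +_) (∑-distrib-+ L (f ∘ suc) (g ∘ suc))) (interchange (f 0) (g 0) _ _)

∑-split : ∀ a b (f : ℕ → ℕ) → ∑< (a + b) f ≡ ∑< a f + ∑[ i < b ] f (a + i)
∑-split zero    b f = refl
∑-split (suc a) b f = trans (cong (f 0 +_) (∑-split a b (f ∘ suc))) (sym (+-assoc (f 0) _ _))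

∑-last : ∀ L (f : ℕ → ℕ) → ∑< (suc L) f ≡ ∑< L f + f L
∑-last zero    f = +-comm (f 0) 0
∑-last (suc L) f = trans (cong (f 0 +_) (∑-last L (f ∘ suc))) (sym (+-assoc (f 0) _ _))

∑-reverse : ∀ L (f : ℕ → ℕ) → ∑[ i < L ] f (L ∸ suc i) ≡ ∑< L f
∑-reverse zero    f = refl
∑-reverse (suc L) f = begin
  f L + ∑[ i < L ] f (L ∸ suc i)  ≡⟨ cong (f L +_) (∑-reverse L f) ⟩
  f L + ∑< L f                    ≡⟨ +-comm (f L) _ ⟩
  ∑< L f + f L                    ≡⟨ ∑-last L f ⟨
  ∑< (suc L) f                    ∎
  where open ≡-Reasoning

∑𝟙≤ : ∀ L (b : ℕ → Bool) → ∑[ i < L ] 𝟙 (b i) ≤ L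
∑𝟙≤ zero    b = z≤n
∑𝟙≤ (suc L) b = +-mono-≤ (𝟙≤1 (b 0)) (∑𝟙≤ L (b ∘ suc))

∑𝟙[≡ᵇ]≤1 : ∀ L a → ∑[ i < L ] 𝟙 (i ≡ᵇ a) ≤ 1
∑𝟙[≡ᵇ]≤1 zero    a       = z≤n
∑𝟙[≡ᵇ]≤1 (suc L) zero    = ≤-reflexive (cong suc (∑-zero L))
∑𝟙[≡ᵇ]≤1 (suc L) (suc a) = ∑𝟙[≡ᵇ]≤1 L a

∑𝟙[≡ᵇ∧]≤ : ∀ L a c → ∑[ i < L ] 𝟙 ((i ≡ᵇ a) ∧ c) ≤ 𝟙 c
∑𝟙[≡ᵇ∧]≤ L a true  = ≤-trans (≤-reflexive (∑-cong L (λ i _ → cong 𝟙 (∧-identityʳ (i ≡ᵇ a)))))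
                              (∑𝟙[≡ᵇ]≤1 L a)
∑𝟙[≡ᵇ∧]≤ L a false = ≤-reflexive (trans (∑-cong L (λ i _ → cong 𝟙 (∧-zeroʳ (i ≡ᵇ a)))) (∑-zero L))

T-≡ᵇ∧ : ∀ {w a} (Q : ℕ → Bool) → w ≡ a → T (Q w) → T ((w ≡ᵇ a) ∧ Q a)
T-≡ᵇ∧ {w} Q refl Qw rewrite ≡ᵇ-refl w = Qw

∑𝟙≤three : ∀ L (P Q : ℕ → Bool) a b c → (∀ w → w < L → T (P w) → T (Q w) × (w ≡ a ⊎ w ≡ b ⊎ w ≡ c)) →
           ∑[ w < L ] 𝟙 (P w) ≤ 𝟙 (Q a) + (𝟙 (Q b) + 𝟙 (Q c))
∑𝟙≤three L P Q a b c only = begin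
  ∑[ w < L ] 𝟙 (P w)
    ≤⟨ ∑-mono-≤ L (λ w w<L → 𝟙-≤-⊎ _ _ _ _ (at w w<L)) ⟩
  ∑[ w < L ] (𝟙 (is w a) + (𝟙 (is w b) + 𝟙 (is w c)))
    ≡⟨ trans (∑-distrib-+ L _ _) (cong (∑[ w < L ] 𝟙 (is w a) +_) (∑-distrib-+ L _ _)) ⟩
  ∑[ w < L ] 𝟙 (is w a) + (∑[ w < L ] 𝟙 (is w b) + ∑[ w < L ] 𝟙 (is w c))
    ≤⟨ +-mono-≤ (∑𝟙[≡ᵇ∧]≤ L a _) (+-mono-≤ (∑𝟙[≡ᵇ∧]≤ L b _) (∑𝟙[≡ᵇ∧]≤ L c _)) ⟩
  𝟙 (Q a) + (𝟙 (Q b) + 𝟙 (Q c)) ∎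
  where
  open ≤-Reasoning
  is : ℕ → ℕ → Bool
  is w x = (w ≡ᵇ x) ∧ Q x
  at : ∀ w → w < L → T (P w) → T (is w a) ⊎ T (is w b) ⊎ T (is w c)
  at w w<L Pw with only w w<L Pw
  ... | Qw , inj₁ w≡a        = inj₁ (T-≡ᵇ∧ Q w≡a Qw)
  ... | Qw , inj₂ (inj₁ w≡b) = inj₂ (inj₁ (T-≡ᵇ∧ Q w≡b Qw))
  ... | Qw , inj₂ (inj₂ w≡c) = inj₂ (inj₂ (T-≡ᵇ∧ Q w≡c Qw))

length-filterᵇ : ∀ {A : Set} (P : A → Bool) xs → length (filterᵇ P xs) ≡ sum (map (𝟙 ∘ P) xs)
length-filterᵇ P []       = refl
length-filterᵇ P (x ∷ xs) with P x
... | true  = cong suc (length-filterᵇ P xs)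
... | false = length-filterᵇ P xs

sum-map-concatMap : ∀ {A B : Set} (g : B → ℕ) (f : A → List B) xs →
                    sum (map g (concatMap f xs)) ≡ sum (map (sum ∘ map g ∘ f) xs)
sum-map-concatMap g f []       = refl
sum-map-concatMap g f (x ∷ xs) = begin
  sum (map g (f x ++ concatMap f xs))                 ≡⟨ cong sum (map-++ g (f x) _) ⟩
  sum (map g (f x) ++ map g (concatMap f xs))         ≡⟨ sum-++ (map g (f x)) _ ⟩
  sum (map g (f x)) + sum (map g (concatMap f xs))
    ≡⟨ cong (sum (map g (f x)) +_) (sum-map-concatMap g f xs) ⟩
  sum (map g (f x)) + sum (map (sum ∘ map g ∘ f) xs)  ∎
  where open ≡-Reasoning

sum-map-allFin : ∀ n (F : ℕ → ℕ) → sum (map (F ∘ toℕ) (allFin n)) ≡ ∑< n F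
sum-map-allFin n F = trans (cong sum (map-tabulate {n = n} id (F ∘ toℕ))) (sum-tabulate n F)
  where
  sum-tabulate : ∀ n F → sum (tabulate {n = n} (F ∘ toℕ)) ≡ ∑< n F
  sum-tabulate zero    F = refl
  sum-tabulate (suc n) F = cong (F 0 +_) (sum-tabulate n (F ∘ suc))

count-allFin : ∀ n (P : ℕ → Bool) → length (filterᵇ (P ∘ toℕ) (allFin n)) ≡ ∑[ i < n ] 𝟙 (P i)
count-allFin n P = trans (length-filterᵇ (P ∘ toℕ) (allFin n)) (sum-map-allFin n (𝟙 ∘ P))

-- Chord structures on initial segments

<⊎≡+ : ∀ a i → i < a ⊎ ∃[ j ] i ≡ a + j
<⊎≡+ a i with i <? a
... | yes i<a = inj₁ i<a
... | no  i≮a = inj₂ (i ∸ a , sym (m+[n∸m]≡n (≮⇒≥ i≮a)))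

mirror : ℕ → ℕ → ℕ
mirror L i = L ∸ suc i

mirror-< : ∀ {L i} → i < L → mirror L i < L
mirror-< {suc L} {i} _ = s≤s (m∸n≤m L i)

mirror-involutive : ∀ {L i} → i < L → mirror L (mirror L i) ≡ i
mirror-involutive {suc L} (s≤s i≤L) = m∸[m∸n]≡n i≤L

mirror-injective : ∀ {L i j} → i < L → j < L → mirror L i ≡ mirror L j → i ≡ j
mirror-injective {L} i<L j<L eq =
  trans (sym (mirror-involutive i<L)) (trans (cong (mirror L) eq) (mirror-involutive j<L))

suc-mirror : ∀ {L i} → i < L → suc (mirror L i) ≡ L ∸ i
suc-mirror i<L = sym (+-∸-assoc 1 i<L)

mirror-<ᵇ : ∀ {L a c} → a < L → c < L → (mirror L a <ᵇ mirror L c) ≡ (c <ᵇ a)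
mirror-<ᵇ {L} {a} {c} a<L c<L = T-extensional to from
  where
  to : T (mirror L a <ᵇ mirror L c) → T (c <ᵇ a)
  to t with c <? a
  ... | yes c<a = <⇒<ᵇ c<a
  ... | no  c≮a = ⊥-elim (<⇒≱ (<ᵇ⇒< _ _ t) (∸-monoʳ-≤ L (s≤s (≮⇒≥ c≮a))))
  from : T (c <ᵇ a) → T (mirror L a <ᵇ mirror L c)
  from t = <⇒<ᵇ (∸-monoʳ-< (s≤s (<ᵇ⇒< c a t)) a<L)

-- Vertex i of the path 0, …, L − 1 is joined by a chord to q i; q i ≡ i means no chord at i.
Involution : (ℕ → ℕ) → ℕ → Set
Involution q L = ∀ i → i < L → q i < L × q (q i) ≡ i

append : ℕ → (ℕ → ℕ) → (ℕ → ℕ) → ℕ → ℕ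
append a q₁ q₂ i = if i <ᵇ a then q₁ i else a + q₂ (i ∸ a)

prepend : (ℕ → ℕ) → ℕ → ℕ
prepend = append 1 id

reverse : ℕ → (ℕ → ℕ) → ℕ → ℕ
reverse L q = mirror L ∘ q ∘ mirror L

addChord : ℕ → ℕ → (ℕ → ℕ) → ℕ → ℕ
addChord x y q i = if i ≡ᵇ x then y else if i ≡ᵇ y then x else q i

hub : ℕ → (ℕ → ℕ) → (ℕ → ℕ) → ℕ → ℕ
hub l q₁ q₂ = append l (reverse l q₁) (prepend q₂)

append-< : ∀ {a} q₁ q₂ {i} → i < a → append a q₁ q₂ i ≡ q₁ i
append-< q₁ q₂ i<a rewrite <⇒<ᵇ≡true i<a = refl

append-+ : ∀ a q₁ q₂ j → append a q₁ q₂ (a + j) ≡ a + q₂ j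
append-+ a q₁ q₂ j rewrite ≮⇒<ᵇ≡false (m+n≮m a j) | m+n∸m≡n a j = refl

hub-centre : ∀ l q₁ q₂ → hub l q₁ q₂ l ≡ l
hub-centre l q₁ q₂ = begin
  hub l q₁ q₂ l        ≡⟨ cong (hub l q₁ q₂) (+-identityʳ l) ⟨
  hub l q₁ q₂ (l + 0)  ≡⟨ append-+ l (reverse l q₁) (prepend q₂) 0 ⟩
  l + 0                ≡⟨ +-identityʳ l ⟩
  l                    ∎
  where open ≡-Reasoning

addChord-x : ∀ x y q → addChord x y q x ≡ y
addChord-x x y q rewrite ≡ᵇ-refl x = refl

addChord-y : ∀ {x y} q → x ≢ y → addChord x y q y ≡ x
addChord-y {x} {y} q x≢y rewrite ≢⇒≡ᵇ≡false (x≢y ∘ sym) | ≡ᵇ-refl y = refl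

addChord-other : ∀ {x y} q {i} → i ≢ x → i ≢ y → addChord x y q i ≡ q i
addChord-other q i≢x i≢y rewrite ≢⇒≡ᵇ≡false i≢x | ≢⇒≡ᵇ≡false i≢y = refl

Involution-id : ∀ L → Involution id L
Involution-id L i i<L = i<L , refl

Involution-append : ∀ {q₁ q₂} a b → Involution q₁ a → Involution q₂ b →
                    Involution (append a q₁ q₂) (a + b)
Involution-append {q₁} {q₂} a b inv₁ inv₂ i i< with <⊎≡+ a i
... | inj₁ i<a rewrite append-< q₁ q₂ i<a =
  let q₁i<a , q₁q₁i≡i = inv₁ i i<a in
  ≤-trans q₁i<a (m≤m+n a b) , trans (append-< q₁ q₂ q₁i<a) q₁q₁i≡i
... | inj₂ (j , refl) rewrite append-+ a q₁ q₂ j =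
  let q₂j<b , q₂q₂j≡j = inv₂ j (+-cancelˡ-< a j b i<) in
  +-monoʳ-< a q₂j<b , trans (append-+ a q₁ q₂ (q₂ j)) (cong (a +_) q₂q₂j≡j)

Involution-prepend : ∀ {q} L → Involution q L → Involution (prepend q) (suc L)
Involution-prepend L = Involution-append 1 L (Involution-id 1)

Involution-reverse : ∀ {q} L → Involution q L → Involution (reverse L q) L
Involution-reverse {q} L inv i i<L =
  let j<L           = mirror-< i<L
      qj<L , qqj≡j  = inv (mirror L i) j<L
  in mirror-< qj<L , (begin
       mirror L (q (mirror L (mirror L (q (mirror L i))))) ≡⟨ cong (mirror L ∘ q) (mirror-involutive qj<L) ⟩
       mirror L (q (q (mirror L i)))                       ≡⟨ cong (mirror L) qqj≡j ⟩
       mirror L (mirror L i)                               ≡⟨ mirror-involutive i<L ⟩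
       i                                                   ∎)
  where open ≡-Reasoning

Involution-addChord : ∀ {q} L {x y} → x < L → y < L → x ≢ y → q x ≡ x → q y ≡ y →
                      Involution q L → Involution (addChord x y q) L
Involution-addChord {q} L {x} {y} x<L y<L x≢y qx≡x qy≡y inv i i<L with i ≟ x | i ≟ y
... | yes refl | _        rewrite addChord-x i y q = y<L , addChord-y q x≢y
... | no  _    | yes refl rewrite addChord-y q x≢y = x<L , addChord-x x i q
... | no  i≢x  | no  i≢y  rewrite addChord-other q i≢x i≢y =
  qi<L , trans (addChord-other q (i≢x ∘ fixed qx≡x) (i≢y ∘ fixed qy≡y)) qqi≡i
  where
  qi<L = proj₁ (inv i i<L)
  qqi≡i = proj₂ (inv i i<L)
  fixed : ∀ {z} → q z ≡ z → q i ≡ z → i ≡ z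
  fixed qz≡z qi≡z = trans (sym qqi≡i) (trans (cong q qi≡z) qz≡z)

Involution-hub : ∀ {q₁ q₂} l m → Involution q₁ l → Involution q₂ m → Involution (hub l q₁ q₂) (l + suc m)
Involution-hub l m inv₁ inv₂ =
  Involution-append l (suc m) (Involution-reverse l inv₁) (Involution-prepend m inv₂)

-- Walks along a chorded path

data Link (q : ℕ → ℕ) (L : ℕ) (u v : ℕ) : Set where
  forward  : suc u ≡ v → v < L → Link q L u v
  backward : suc v ≡ u → u < L → Link q L u v
  chord    : u < L → v ≡ q u → u ≢ v → Link q L u v

data Chain (_∼_ : ℕ → ℕ → Set) : ℕ → ℕ → ℕ → Set where
  ε   : ∀ {v} → Chain _∼_ v v 0
  _◅_ : ∀ {u w v k} → u ∼ w → Chain _∼_ w v k → Chain _∼_ u v (suc k)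

Chain-map : ∀ {R₁ R₂ : ℕ → ℕ → Set} (f : ℕ → ℕ) → (∀ {u v} → R₁ u v → R₂ (f u) (f v)) →
            ∀ {u v k} → Chain R₁ u v k → Chain R₂ (f u) (f v) k
Chain-map f lift ε       = ε
Chain-map f lift (r ◅ c) = lift r ◅ Chain-map f lift c

Link-appendˡ : ∀ {q₁ a} q₂ b {u v} → Link q₁ a u v → Link (append a q₁ q₂) (a + b) u v
Link-appendˡ {a = a} q₂ b (forward  eq v<a) = forward eq (<-≤-trans v<a (m≤m+n a b))
Link-appendˡ {a = a} q₂ b (backward eq u<a) = backward eq (<-≤-trans u<a (m≤m+n a b))
Link-appendˡ {q₁} {a} q₂ b (chord u<a refl u≢v) =
  chord (<-≤-trans u<a (m≤m+n a b)) (sym (append-< q₁ q₂ u<a)) u≢v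

Link-appendʳ : ∀ a q₁ {q₂ b u v} → Link q₂ b u v → Link (append a q₁ q₂) (a + b) (a + u) (a + v)
Link-appendʳ a q₁ {u = u} (forward refl v<b)  = forward (sym (+-suc a u)) (+-monoʳ-< a v<b)
Link-appendʳ a q₁ {v = v} (backward refl u<b) = backward (sym (+-suc a v)) (+-monoʳ-< a u<b)
Link-appendʳ a q₁ {q₂} {u = u} (chord u<b refl u≢v) =
  chord (+-monoʳ-< a u<b) (sym (append-+ a q₁ q₂ u)) (u≢v ∘ +-cancelˡ-≡ a _ _)

Link-reverse : ∀ {q L u v} → Involution q L → Link q L u v → Link (reverse L q) L (mirror L u) (mirror L v)
Link-reverse {u = u} inv (forward refl v<L) =
  backward (suc-mirror v<L) (mirror-< (<-trans (n<1+n u) v<L))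
Link-reverse {v = v} inv (backward refl u<L) =
  forward (suc-mirror u<L) (mirror-< (<-trans (n<1+n v) u<L))
Link-reverse {q} {L} {u} inv (chord u<L refl u≢v) =
  chord (mirror-< u<L) (cong (mirror L ∘ q) (sym (mirror-involutive u<L)))
        (u≢v ∘ mirror-injective u<L (proj₁ (inv u u<L)))

Link-addChord : ∀ {q L x y u v} → q x ≡ x → q y ≡ y → Link q L u v → Link (addChord x y q) L u v
Link-addChord qx≡x qy≡y (forward eq v<L)  = forward eq v<L
Link-addChord qx≡x qy≡y (backward eq u<L) = backward eq u<L
Link-addChord {q} qx≡x qy≡y (chord u<L refl u≢v) =
  chord u<L (sym (addChord-other q (λ { refl → u≢v (sym qx≡x) }) (λ { refl → u≢v (sym qy≡y) }))) u≢v

Link-hubˡ : ∀ {q₁ l} q₂ m {u v} → Involution q₁ l → Link q₁ l u v →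
            Link (hub l q₁ q₂) (l + suc m) (mirror l u) (mirror l v)
Link-hubˡ q₂ m inv = Link-appendˡ (prepend q₂) (suc m) ∘ Link-reverse inv

Link-hubʳ : ∀ l q₁ {q₂ m u v} → Link q₂ m u v → Link (hub l q₁ q₂) (l + suc m) (l + suc u) (l + suc v)
Link-hubʳ l q₁ = Link-appendʳ l (reverse l q₁) ∘ Link-appendʳ 1 id

Reach≤ : (ℕ → ℕ) → ℕ → ℕ → ℕ → ℕ → Set
Reach≤ q L u v b = ∃[ d ] (d ≤ b × Chain (Link q L) u v d)

Ecc≤ : (ℕ → ℕ) → ℕ → ℕ → ℕ → Set
Ecc≤ q L r b = ∀ i → i < L → Reach≤ q L r i b

Reach≤-via : ∀ {q L q′ L′ r r′ b} (f : ℕ → ℕ) → (∀ {u v} → Link q′ L′ u v → Link q L (f u) (f v)) →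
             Link q L r (f r′) → Ecc≤ q′ L′ r′ b → ∀ i → i < L′ → Reach≤ q L r (f i) (suc b)
Reach≤-via f lift r∼fr′ ecc i i<L′ with ecc i i<L′
... | d , d≤b , c = suc d , s≤s d≤b , r∼fr′ ◅ Chain-map f lift c

Ecc≤-hub : ∀ {q₁ q₂ b} l m → Involution q₁ l → Ecc≤ q₁ l 0 b → Ecc≤ q₂ m 0 b →
           Ecc≤ (hub l q₁ q₂) (l + suc m) l (suc b)
Ecc≤-hub {q₁} {q₂} l m inv₁ ecc₁ ecc₂ i i< with <⊎≡+ l i
... | inj₁ i<l =
  subst (λ t → Reach≤ (hub l q₁ q₂) (l + suc m) l t _) (mirror-involutive i<l)
    (Reach≤-via (mirror l) (Link-hubˡ q₂ m inv₁) (backward (suc-mirror (≤-<-trans z≤n i<l)) centre<)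
                ecc₁ (mirror l i) (mirror-< i<l))
  where centre< = m<m+n l z<s
... | inj₂ (zero , refl) =
  0 , z≤n , subst (λ v → Chain (Link (hub l q₁ q₂) (l + suc m)) l v 0) (sym (+-identityʳ l)) ε
... | inj₂ (suc k , refl) =
  Reach≤-via (λ j → l + suc j) (Link-hubʳ l q₁)
             (forward (+-comm 1 l) (+-monoʳ-< l (s≤s (≤-<-trans z≤n k<m)))) ecc₂ k k<m
  where k<m = s≤s⁻¹ (+-cancelˡ-< l (suc k) (suc m) i<)

-- Counting chords

-- Chords counted at their lower and at their upper end. For an involution both counts agree,
-- but reversal exchanges them, so both are tracked.
ups : (ℕ → ℕ) → ℕ → ℕ
ups q L = ∑[ i < L ] 𝟙 (i <ᵇ q i)

downs : (ℕ → ℕ) → ℕ → ℕ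
downs q L = ∑[ i < L ] 𝟙 (q i <ᵇ i)

ups-append : ∀ a b q₁ q₂ → ups (append a q₁ q₂) (a + b) ≡ ups q₁ a + ups q₂ b
ups-append a b q₁ q₂ = trans (∑-split a b _) (cong₂ _+_
  (∑-cong a (λ i i<a → cong (λ t → 𝟙 (i <ᵇ t)) (append-< q₁ q₂ i<a)))
  (∑-cong b (λ j _ → trans (cong (λ t → 𝟙 (a + j <ᵇ t)) (append-+ a q₁ q₂ j))
                           (cong 𝟙 (+-cancelˡ-<ᵇ a j (q₂ j))))))

downs-append : ∀ a b q₁ q₂ → downs (append a q₁ q₂) (a + b) ≡ downs q₁ a + downs q₂ b
downs-append a b q₁ q₂ = trans (∑-split a b _) (cong₂ _+_
  (∑-cong a (λ i i<a → cong (λ t → 𝟙 (t <ᵇ i)) (append-< q₁ q₂ i<a)))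
  (∑-cong b (λ j _ → trans (cong (λ t → 𝟙 (t <ᵇ a + j)) (append-+ a q₁ q₂ j))
                           (cong 𝟙 (+-cancelˡ-<ᵇ a (q₂ j) j)))))

ups-reverse : ∀ L q → Involution q L → ups (reverse L q) L ≡ downs q L
ups-reverse L q inv = trans (∑-cong L reflect) (∑-reverse L (λ j → 𝟙 (q j <ᵇ j)))
  where
  reflect : ∀ i → i < L → 𝟙 (i <ᵇ reverse L q i) ≡ 𝟙 (q (mirror L i) <ᵇ mirror L i)
  reflect i i<L = trans (cong (λ t → 𝟙 (t <ᵇ reverse L q i)) (sym (mirror-involutive i<L)))
                        (cong 𝟙 (mirror-<ᵇ (mirror-< i<L) (proj₁ (inv _ (mirror-< i<L)))))

downs-reverse : ∀ L q → Involution q L → downs (reverse L q) L ≡ ups q L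
downs-reverse L q inv = trans (∑-cong L reflect) (∑-reverse L (λ j → 𝟙 (j <ᵇ q j)))
  where
  reflect : ∀ i → i < L → 𝟙 (reverse L q i <ᵇ i) ≡ 𝟙 (mirror L i <ᵇ q (mirror L i))
  reflect i i<L = trans (cong (λ t → 𝟙 (reverse L q i <ᵇ t)) (sym (mirror-involutive i<L)))
                        (cong 𝟙 (mirror-<ᵇ (proj₁ (inv _ (mirror-< i<L))) (mirror-< i<L)))

ups-hub : ∀ l m q₁ q₂ → Involution q₁ l → ups (hub l q₁ q₂) (l + suc m) ≡ downs q₁ l + ups q₂ m
ups-hub l m q₁ q₂ inv = trans (ups-append l (suc m) (reverse l q₁) (prepend q₂))
                              (cong (_+ ups q₂ m) (ups-reverse l q₁ inv))

downs-hub : ∀ l m q₁ q₂ → Involution q₁ l → downs (hub l q₁ q₂) (l + suc m) ≡ ups q₁ l + downs q₂ m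
downs-hub l m q₁ q₂ inv = trans (downs-append l (suc m) (reverse l q₁) (prepend q₂))
                                (cong (_+ downs q₂ m) (downs-reverse l q₁ inv))

ups-addChord : ∀ q x y L → x < y → ups (addChord x y q) L ≤ ups q L + 1
ups-addChord q x y L x<y = begin
  ups (addChord x y q) L                        ≤⟨ ∑-mono-≤ L pointwise ⟩
  ∑[ i < L ] (𝟙 (i <ᵇ q i) + 𝟙 (i ≡ᵇ x))       ≡⟨ ∑-distrib-+ L _ _ ⟩
  ups q L + ∑[ i < L ] 𝟙 (i ≡ᵇ x)              ≤⟨ +-monoʳ-≤ (ups q L) (∑𝟙[≡ᵇ]≤1 L x) ⟩
  ups q L + 1                                   ∎
  where
  open ≤-Reasoning
  pointwise : ∀ i → i < L → 𝟙 (i <ᵇ addChord x y q i) ≤ 𝟙 (i <ᵇ q i) + 𝟙 (i ≡ᵇ x)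
  pointwise i _ with i ≟ x
  ... | yes refl rewrite ≡ᵇ-refl i = ≤-trans (𝟙≤1 _) (m≤n+m 1 _)
  ... | no  i≢x with i ≟ y
  ...   | yes refl rewrite addChord-y q (<⇒≢ x<y) | ≮⇒<ᵇ≡false (<⇒≯ x<y) = z≤n
  ...   | no  i≢y  rewrite addChord-other q i≢x i≢y = m≤m+n _ _

downs-addChord : ∀ q x y L → x < y → downs (addChord x y q) L ≤ downs q L + 1
downs-addChord q x y L x<y = begin
  downs (addChord x y q) L                      ≤⟨ ∑-mono-≤ L pointwise ⟩
  ∑[ i < L ] (𝟙 (q i <ᵇ i) + 𝟙 (i ≡ᵇ y))       ≡⟨ ∑-distrib-+ L _ _ ⟩
  downs q L + ∑[ i < L ] 𝟙 (i ≡ᵇ y)            ≤⟨ +-monoʳ-≤ (downs q L) (∑𝟙[≡ᵇ]≤1 L y) ⟩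
  downs q L + 1                                 ∎
  where
  open ≤-Reasoning
  pointwise : ∀ i → i < L → 𝟙 (addChord x y q i <ᵇ i) ≤ 𝟙 (q i <ᵇ i) + 𝟙 (i ≡ᵇ y)
  pointwise i _ with i ≟ x
  ... | yes refl rewrite addChord-x i y q | ≮⇒<ᵇ≡false (<⇒≯ x<y) = z≤n
  ... | no  i≢x with i ≟ y
  ...   | yes refl rewrite ≡ᵇ-refl i = ≤-trans (𝟙≤1 _) (m≤n+m 1 _)
  ...   | no  i≢y  rewrite addChord-other q i≢x i≢y = m≤m+n _ _

-- Chorded paths

-- The alternative X ≡ 0 is only needed for the empty path.
Sparse : ℕ → ℕ → Set
Sparse X L = 8 * X + 1 ≤ 3 * L ⊎ X ≡ 0

Sparse-suc : ∀ {X L} → Sparse X L → Sparse X (suc L)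
Sparse-suc {L = L} (inj₁ le) = inj₁ (≤-trans le (*-monoʳ-≤ 3 (n≤1+n L)))
Sparse-suc         (inj₂ eq) = inj₂ eq

Sparse-strict : ∀ {X L} → Sparse X (suc L) → 8 * X + 1 ≤ 3 * suc L
Sparse-strict (inj₁ le)   = le
Sparse-strict (inj₂ refl) = s≤s z≤n

Sparse⇒8*≤3* : ∀ {X L} → Sparse X L → 8 * X ≤ 3 * L
Sparse⇒8*≤3* {X} (inj₁ le)   = ≤-trans (m≤m+n (8 * X) 1) le
Sparse⇒8*≤3* (inj₂ refl) = z≤n

-- The new chord costs 8 and the new slack 1; they are paid by the two new vertices (3 * 2)
-- and by the slack 1 of each of the three parts.
Sparse-join : ∀ {a b c x y z X} → Sparse a (suc x) → Sparse b (suc y) → Sparse c (suc z) →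
              X ≤ a + (b + c) + 1 → Sparse X (suc (suc x + (suc y + suc (suc z))))
Sparse-join {a} {b} {c} {x} {y} {z} {X} sa sb sc X≤ = inj₁ (begin
  8 * X + 1                                           ≤⟨ +-monoˡ-≤ 1 (*-monoʳ-≤ 8 X≤) ⟩
  8 * (a + (b + c) + 1) + 1                           ≡⟨ regroup a b c ⟩
  (8 * a + 1) + (8 * b + 1) + (8 * c + 1) + 6         ≤⟨ +-monoˡ-≤ 6 (+-mono-≤ (+-mono-≤ (Sparse-strict sa)
                                                           (Sparse-strict sb)) (Sparse-strict sc)) ⟩
  3 * suc x + 3 * suc y + 3 * suc z + 6               ≡⟨ collect x y z ⟩
  3 * suc (suc x + (suc y + suc (suc z)))             ∎)
  where
  open ≤-Reasoning
  regroup : ∀ a b c → 8 * (a + (b + c) + 1) + 1 ≡ (8 * a + 1) + (8 * b + 1) + (8 * c + 1) + 6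
  regroup = solve-∀
  collect : ∀ x y z → 3 * suc x + 3 * suc y + 3 * suc z + 6 ≡ 3 * suc (suc x + (suc y + suc (suc z)))
  collect = solve-∀

record ChordedPath (r L : ℕ) : Set where
  field
    chords       : ℕ → ℕ
    involution   : Involution chords L
    eccentricity : Ecc≤ chords L 0 r
    sparse-ups   : Sparse (ups chords L) L
    sparse-downs : Sparse (downs chords L) L

open ChordedPath

emptyPath : ∀ {r} → ChordedPath r 0
emptyPath = record
  { chords = id ; involution = Involution-id 0 ; eccentricity = λ _ ()
  ; sparse-ups = inj₂ refl ; sparse-downs = inj₂ refl }

singleton : ∀ {r} → ChordedPath r 1
singleton = record
  { chords = id ; involution = Involution-id 1
  ; eccentricity = λ { zero _ → 0 , z≤n , ε ; (suc _) (s≤s ()) }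
  ; sparse-ups = inj₂ refl ; sparse-downs = inj₂ refl }

triangle : ChordedPath 1 3
triangle = record
  { chords       = addChord 0 2 id
  ; involution   = Involution-addChord 3 z<s (s≤s (s≤s (s≤s z≤n))) (λ ()) refl refl (Involution-id 3)
  ; eccentricity = λ { zero _ → 0 , z≤n , ε
                     ; 1 _ → 1 , ≤-refl , forward refl (s≤s (s≤s z≤n)) ◅ ε
                     ; 2 _ → 1 , ≤-refl , chord z<s refl (λ ()) ◅ ε
                     ; (suc (suc (suc _))) (s≤s (s≤s (s≤s ()))) }
  ; sparse-ups   = inj₁ ≤-refl
  ; sparse-downs = inj₁ ≤-refl }

prependRoot : ∀ {r L} → ChordedPath r L → ChordedPath (suc r) (suc L)
prependRoot {L = L} P = record
  { chords       = prepend (chords P)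
  ; involution   = Involution-prepend L (involution P)
  ; eccentricity = λ { zero _ → 0 , z≤n , ε
                     ; (suc j) (s≤s j<L) → Reach≤-via suc (Link-appendʳ 1 id)
                         (forward refl (s≤s (≤-<-trans z≤n j<L))) (eccentricity P) j j<L }
  ; sparse-ups   = Sparse-suc (sparse-ups P)
  ; sparse-downs = Sparse-suc (sparse-downs P) }

-- Root 0, then A, then B reversed, the hub, then C; the root is joined to the hub by a chord.
module Branch {r a b c} (A : ChordedPath (suc r) (suc a)) (B : ChordedPath r (suc b))
                        (C : ChordedPath r (suc c)) where

  size hubAt : ℕ
  size  = suc (suc a + (suc b + suc (suc c)))
  hubAt = suc (suc a + suc b)

  qA qB qC hubChords body branchChords : ℕ → ℕ
  qA           = chords A
  qB           = chords B
  qC           = chords C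
  hubChords    = hub (suc b) qB qC
  body         = prepend (append (suc a) qA hubChords)
  branchChords = addChord 0 hubAt body

  hubAt<size : hubAt < size
  hubAt<size = s≤s (+-monoʳ-< (suc a) (m<m+n (suc b) z<s))

  body-hubAt : body hubAt ≡ hubAt
  body-hubAt = cong suc (trans (append-+ (suc a) qA hubChords (suc b))
                               (cong (suc a +_) (hub-centre (suc b) qB qC)))

  Link-body : ∀ {u v} → Link body size u v → Link branchChords size u v
  Link-body = Link-addChord refl body-hubAt

  involution-branch : Involution branchChords size
  involution-branch = Involution-addChord size z<s hubAt<size (λ ()) refl body-hubAt
    (Involution-prepend _ (Involution-append (suc a) _ (involution A)
      (Involution-hub (suc b) (suc c) (involution B) (involution C))))

  eccentricity-branch : Ecc≤ branchChords size 0 (suc (suc r))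
  eccentricity-branch zero    _ = 0 , z≤n , ε
  eccentricity-branch (suc j) (s≤s j<) with <⊎≡+ (suc a) j
  ... | inj₁ j<a =
    Reach≤-via suc (Link-body ∘ Link-appendʳ 1 id ∘ Link-appendˡ hubChords _)
               (forward refl (s≤s (s≤s z≤n))) (eccentricity A) j j<a
  ... | inj₂ (t , refl) =
    Reach≤-via (λ t → suc (suc a + t)) (Link-body ∘ Link-appendʳ 1 id ∘ Link-appendʳ (suc a) qA)
               (chord z<s refl (λ ()))
               (Ecc≤-hub (suc b) (suc c) (involution B) (eccentricity B) (eccentricity C))
               t (+-cancelˡ-< (suc a) t _ j<)

  ups-branch : ups branchChords size ≤ ups qA (suc a) + (downs qB (suc b) + ups qC (suc c)) + 1
  ups-branch = ≤-trans (ups-addChord body 0 hubAt size z<s) (≤-reflexive (cong (_+ 1)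
    (trans (ups-append (suc a) _ qA hubChords)
           (cong (ups qA (suc a) +_) (ups-hub (suc b) (suc c) qB qC (involution B))))))

  downs-branch : downs branchChords size ≤ downs qA (suc a) + (ups qB (suc b) + downs qC (suc c)) + 1
  downs-branch = ≤-trans (downs-addChord body 0 hubAt size z<s) (≤-reflexive (cong (_+ 1)
    (trans (downs-append (suc a) _ qA hubChords)
           (cong (downs qA (suc a) +_) (downs-hub (suc b) (suc c) qB qC (involution B))))))

  branch : ChordedPath (suc (suc r)) size
  branch = record
    { chords       = branchChords
    ; involution   = involution-branch
    ; eccentricity = eccentricity-branch
    ; sparse-ups   = Sparse-join (sparse-ups A) (sparse-downs B) (sparse-ups C) ups-branch
    ; sparse-downs = Sparse-join (sparse-downs A) (sparse-ups B) (sparse-downs C) downs-branch }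

open Branch using (branch)

≤+⇒≡+ : ∀ {n} a b → n ≤ a + b → ∃[ x ] ∃[ y ] (n ≡ x + y × x ≤ a × y ≤ b)
≤+⇒≡+ {n} a b n≤a+b with n ≤? a
... | yes n≤a = n , 0 , sym (+-identityʳ n) , n≤a , z≤n
... | no  n≰a = a , n ∸ a , sym (m+[n∸m]≡n (≰⇒≥ n≰a)) , ≤-refl , m≤n+o⇒m∸n≤o n a n≤a+b

branchSizes : ∀ {P L} → 2 ≤ P → 2 * P < L → L < 2 * (2 * P) →
  ∃[ a ] ∃[ b ] ∃[ c ] (L ≡ suc (suc a + (suc b + suc (suc c))) × suc a < 2 * P × suc b < P × suc c < P)
branchSizes {suc (suc p)} {L} (s≤s (s≤s z≤n)) lo hi =
  let a , t , s≡a+t , a≤ , t≤ = ≤+⇒≡+ (2 + 2 * p) (p + p) s≤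
      b , c , t≡b+c , b≤ , c≤ = ≤+⇒≡+ p p t≤
  in a , b , c , L≡ s≡a+t t≡b+c ,
     ≤-trans (s≤s (s≤s a≤)) (≤-reflexive (twice p)) , s≤s (s≤s b≤) , s≤s (s≤s c≤)
  where
  twice : ∀ p → 2 + (2 + 2 * p) ≡ 2 * (2 + p)
  twice = solve-∀
  5≤L : 5 ≤ L
  5≤L = ≤-trans (m≤m+n 5 (2 * p)) (≤-trans (≤-reflexive (five p)) lo)
    where five : ∀ p → 5 + 2 * p ≡ suc (2 * (2 + p))
          five = solve-∀
  s≤ : L ∸ 5 ≤ (2 + 2 * p) + (p + p)
  s≤ = m≤n+o⇒m∸n≤o L 5 (s≤s⁻¹ (≤-trans hi (≤-reflexive (eight p))))
    where eight : ∀ p → 2 * (2 * (2 + p)) ≡ suc (5 + ((2 + 2 * p) + (p + p)))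
          eight = solve-∀
  L≡ : ∀ {a b c t} → L ∸ 5 ≡ a + t → t ≡ b + c → L ≡ suc (suc a + (suc b + suc (suc c)))
  L≡ {a} {b} {c} {t} s≡a+t t≡b+c = begin
    L                                   ≡⟨ m+[n∸m]≡n 5≤L ⟨
    5 + (L ∸ 5)                         ≡⟨ cong (5 +_) s≡a+t ⟩
    5 + (a + t)                         ≡⟨ cong (λ t → 5 + (a + t)) t≡b+c ⟩
    5 + (a + (b + c))                   ≡⟨ regroup a b c ⟩
    suc (suc a + (suc b + suc (suc c))) ∎
    where
    open ≡-Reasoning
    regroup : ∀ a b c → 5 + (a + (b + c)) ≡ suc (suc a + (suc b + suc (suc c)))
    regroup = solve-∀

2≤2^suc : ∀ r → 2 ≤ 2 ^ suc r
2≤2^suc r = *-monoʳ-≤ 2 (m^n>0 2 r)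

ChordedPaths : ℕ → Set
ChordedPaths r = ∀ L → L < 2 ^ suc r → ChordedPath r L

chordedPaths-step : ∀ r → ChordedPaths (suc r) → ChordedPaths r → ChordedPaths (suc (suc r))
chordedPaths-step r rec₁ rec₀ 0       _  = emptyPath
chordedPaths-step r rec₁ rec₀ (suc L) L< with suc L ≤? 2 ^ suc (suc r)
... | yes L<2P = prependRoot (rec₁ L L<2P)
... | no  L≮2P with branchSizes (2≤2^suc r) (≰⇒> L≮2P) L<
... | a , b , c , refl , a< , b< , c< = branch (rec₁ (suc a) a<) (rec₀ (suc b) b<) (rec₀ (suc c) c<)

chordedPath : ∀ r → ChordedPaths r
chordedPath 0             0 _ = emptyPath
chordedPath 0             1 _ = singleton
chordedPath 1             0 _ = emptyPath
chordedPath 1             1 _ = singleton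
chordedPath 1             2 _ = prependRoot singleton
chordedPath 1             3 _ = triangle
chordedPath 0             (suc (suc _)) (s≤s (s≤s ()))
chordedPath 1             (suc (suc (suc (suc _)))) (s≤s (s≤s (s≤s (s≤s ()))))
chordedPath (suc (suc r)) = chordedPaths-step r (chordedPath (suc r)) (chordedPath r)

-- The cycle with chords

Walk-++ : ∀ {n} {G : Graph n} {u w v a b} → Walk G u w a → Walk G w v b → Walk G u v (a + b)
Walk-++ here         q = q
Walk-++ (step u∼w p) q = step u∼w (Walk-++ p q)

Walk-reverse : ∀ {n} {G : Graph n} {u v k} → Walk G u v k → Walk G v u k
Walk-reverse here = here
Walk-reverse {G = G} {u} {v} {suc k} (step {w = w} u∼w p) =
  subst (Walk G v u) (+-comm k 1) (Walk-++ (Walk-reverse p) (step (subst T (Graph.sym G u w) u∼w) here))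

Diameter≤-centre : ∀ {n} {G : Graph n} (c : Fin n) {k} → (∀ v → Dist≤ G c v k) → Diameter≤ G (2 * k)
Diameter≤-centre c {k} near u v =
  let d₁ , d₁≤k , p₁ = near u
      d₂ , d₂≤k , p₂ = near v
  in d₁ + d₂ , ≤-trans (+-mono-≤ d₁≤k d₂≤k) (≤-reflexive (cong (k +_) (sym (+-identityʳ k)))) ,
     Walk-++ (Walk-reverse p₁) p₂

module CycleWithChords (n : ℕ) (p : ℕ → ℕ) (p-inv : Involution p n) where

  cycleSuc cyclePred : ℕ → ℕ
  cycleSuc  u = if suc u ≡ᵇ n then 0 else suc u
  cyclePred u = if u ≡ᵇ 0 then pred n else pred u

  adjacent : ℕ → ℕ → Bool
  adjacent u v = not (u ≡ᵇ v) ∧ ((v ≡ᵇ cycleSuc u) ∨ ((u ≡ᵇ cycleSuc v) ∨ (v ≡ᵇ p u)))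

  partner : ∀ {u v} → u < n → v ≡ p u → u ≡ p v
  partner u<n refl = sym (proj₂ (p-inv _ u<n))

  chord-comm : ∀ {u v} → u < n → v < n → (v ≡ᵇ p u) ≡ (u ≡ᵇ p v)
  chord-comm {u} {v} u<n v<n = T-extensional (≡⇒≡ᵇ u (p v) ∘ partner u<n ∘ ≡ᵇ⇒≡ v (p u))
                                             (≡⇒≡ᵇ v (p u) ∘ partner v<n ∘ ≡ᵇ⇒≡ u (p v))

  adjacent-comm : ∀ {u v} → u < n → v < n → adjacent u v ≡ adjacent v u
  adjacent-comm {u} {v} u<n v<n rewrite ≡ᵇ-comm u v | chord-comm u<n v<n =
    cong (not (v ≡ᵇ u) ∧_) (∨-swap (v ≡ᵇ cycleSuc u) (u ≡ᵇ cycleSuc v) (u ≡ᵇ p v))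

  adjacent-irrefl : ∀ u → adjacent u u ≡ false
  adjacent-irrefl u rewrite ≡ᵇ-refl u = refl

  graph : Graph n
  graph = record
    { adj    = λ u v → adjacent (toℕ u) (toℕ v)
    ; sym    = λ u v → adjacent-comm (toℕ<n u) (toℕ<n v)
    ; irrefl = adjacent-irrefl ∘ toℕ }

  cycleSuc-< : ∀ {u} → suc u < n → cycleSuc u ≡ suc u
  cycleSuc-< {u} 1+u<n rewrite ≢⇒≡ᵇ≡false (<⇒≢ 1+u<n) = refl

  cycleSuc-last : 0 < n → cycleSuc (n ∸ 1) ≡ 0
  cycleSuc-last 0<n rewrite suc-mirror {n} {0} 0<n | ≡ᵇ-refl n = refl

  cycleSuc⇒cyclePred : ∀ {u w} → w < n → u ≡ cycleSuc w → w ≡ cyclePred u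
  cycleSuc⇒cyclePred {w = w} w<n refl with suc w ≟ n
  ... | yes refl rewrite ≡ᵇ-refl (suc w)   = refl
  ... | no  1+w≢n rewrite ≢⇒≡ᵇ≡false 1+w≢n = refl

  adjacent-intro : ∀ {u v} → u ≢ v → v ≡ cycleSuc u ⊎ u ≡ cycleSuc v ⊎ v ≡ p u → T (adjacent u v)
  adjacent-intro {u} {v} u≢v cases =
    T-not∧∨∨ (u ≡ᵇ v) (v ≡ᵇ cycleSuc u) (u ≡ᵇ cycleSuc v) (v ≡ᵇ p u)
             (u≢v ∘ ≡ᵇ⇒≡ u v) (Sum.map test (Sum.map test test) cases)
    where
    test : ∀ {m n} → m ≡ n → T (m ≡ᵇ n)
    test = ≡⇒≡ᵇ _ _

  Link⇒adjacent : ∀ {u v} → Link p n u v → T (adjacent u v)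
  Link⇒adjacent (forward refl 1+u<n)  = adjacent-intro (1+n≢n ∘ sym) (inj₁ (sym (cycleSuc-< 1+u<n)))
  Link⇒adjacent (backward refl 1+v<n) = adjacent-intro 1+n≢n (inj₂ (inj₁ (sym (cycleSuc-< 1+v<n))))
  Link⇒adjacent (chord _ refl u≢pu)   = adjacent-intro u≢pu (inj₂ (inj₂ refl))

  Link-target< : ∀ {u v} → Link p n u v → v < n
  Link-target< (forward _ v<n)       = v<n
  Link-target< (backward refl 1+v<n) = <-trans (n<1+n _) 1+v<n
  Link-target< (chord u<n refl _)    = proj₁ (p-inv _ u<n)

  Chain⇒Walk : ∀ {a b k} → Chain (Link p n) a b k →
               ∀ {x y : Fin n} → toℕ x ≡ a → toℕ y ≡ b → Walk graph x y k
  Chain⇒Walk ε {x} {y} x≡a y≡a rewrite toℕ-injective {i = x} {j = y} (trans x≡a (sym y≡a)) = here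
  Chain⇒Walk (u∼w ◅ c) {x} refl y≡b =
    step (subst (T ∘ adjacent (toℕ x)) (sym (toℕ-fromℕ< w<n)) (Link⇒adjacent u∼w))
         (Chain⇒Walk c (toℕ-fromℕ< w<n) y≡b)
    where w<n = Link-target< u∼w

  Reach≤⇒Dist≤ : ∀ {x y : Fin n} {b} → Reach≤ p n (toℕ x) (toℕ y) b → Dist≤ graph x y b
  Reach≤⇒Dist≤ (d , d≤b , c) = d , d≤b , Chain⇒Walk c refl refl

  hamiltonian : 3 ≤ n → Hamiltonian graph
  hamiltonian 3≤n = 3≤n , id , id ,
    (λ i j 1+i≡j → Link⇒adjacent (forward 1+i≡j (toℕ<n j))) ,
    (λ i j i≡n-1 j≡0 → subst₂ (λ a b → T (adjacent a b)) (sym i≡n-1) (sym j≡0) wrap)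
    where
    0<n = ≤-trans (s≤s z≤n) 3≤n
    wrap : T (adjacent (n ∸ 1) 0)
    wrap = adjacent-intro (m>n⇒m∸n≢0 (≤-trans (s≤s (s≤s z≤n)) 3≤n)) (inj₁ (sym (cycleSuc-last 0<n)))

  neighbours : ∀ {u w} → w < n → T (adjacent u w) → w ≡ cycleSuc u ⊎ w ≡ cyclePred u ⊎ w ≡ p u
  neighbours {u} {w} w<n adj with T-not∧∨∨⁻ (u ≡ᵇ w) _ _ _ adj
  ... | inj₁ t        = inj₁ (≡ᵇ⇒≡ w _ t)
  ... | inj₂ (inj₁ t) = inj₂ (inj₁ (cycleSuc⇒cyclePred w<n (≡ᵇ⇒≡ u _ t)))
  ... | inj₂ (inj₂ t) = inj₂ (inj₂ (≡ᵇ⇒≡ w _ t))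

  degree≤3 : MaxDegree≤ graph 3
  degree≤3 v = begin
    degree graph v
      ≡⟨ count-allFin n (adjacent (toℕ v)) ⟩
    ∑[ w < n ] 𝟙 (adjacent (toℕ v) w)
      ≤⟨ ∑𝟙≤three n _ (λ _ → true) _ _ _ (λ _ w<n adj → tt , neighbours w<n adj) ⟩
    3 ∎
    where open ≤-Reasoning

  -- Only the closing edge of the cycle leads up from a vertex to its cyclic predecessor.
  cyclePred-ups : ∑[ u < n ] 𝟙 (u <ᵇ cyclePred u) ≤ 1
  cyclePred-ups = ≤-trans (∑-mono-≤ n only0) (∑𝟙[≡ᵇ]≤1 n 0)
    where
    only0 : ∀ u → u < n → 𝟙 (u <ᵇ cyclePred u) ≤ 𝟙 (u ≡ᵇ 0)
    only0 zero    _ = 𝟙≤1 _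
    only0 (suc u) _ rewrite ≮⇒<ᵇ≡false (≤⇒≯ (n≤1+n u)) = z≤n

  numEdges≤ : numEdges graph ≤ n + (1 + ups p n)
  numEdges≤ = begin
    numEdges graph
      ≡⟨ length-filterᵇ isEdge (concatMap row (allFin n)) ⟩
    sum (map (𝟙 ∘ isEdge) (concatMap row (allFin n)))
      ≡⟨ sum-map-concatMap (𝟙 ∘ isEdge) row (allFin n) ⟩
    sum (map (sum ∘ map (𝟙 ∘ isEdge) ∘ row) (allFin n))
      ≡⟨ cong sum (map-cong rowCount (allFin n)) ⟩
    sum (map (later ∘ toℕ) (allFin n))
      ≡⟨ sum-map-allFin n later ⟩
    ∑[ u < n ] later u
      ≤⟨ ∑-mono-≤ n (λ u _ → ∑𝟙≤three n _ (u <ᵇ_) _ _ _ (laterNeighbours u)) ⟩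
    ∑[ u < n ] (𝟙 (u <ᵇ cycleSuc u) + (𝟙 (u <ᵇ cyclePred u) + 𝟙 (u <ᵇ p u)))
      ≡⟨ trans (∑-distrib-+ n _ _) (cong (∑[ u < n ] 𝟙 (u <ᵇ cycleSuc u) +_) (∑-distrib-+ n _ _)) ⟩
    ∑[ u < n ] 𝟙 (u <ᵇ cycleSuc u) + (∑[ u < n ] 𝟙 (u <ᵇ cyclePred u) + ups p n)
      ≤⟨ +-mono-≤ (∑𝟙≤ n _) (+-monoˡ-≤ (ups p n) cyclePred-ups) ⟩
    n + (1 + ups p n) ∎
    where
    open ≤-Reasoning
    isEdge : Fin n × Fin n → Bool
    isEdge (u , v) = (toℕ u <ᵇ toℕ v) ∧ adj graph u v
    row : Fin n → List (Fin n × Fin n)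
    row u = map (u ,_) (allFin n)
    later : ℕ → ℕ
    later u = ∑[ w < n ] 𝟙 ((u <ᵇ w) ∧ adjacent u w)
    rowCount : ∀ u → sum (map (𝟙 ∘ isEdge) (row u)) ≡ later (toℕ u)
    rowCount u = trans (cong sum (sym (map-∘ (allFin n))))
                       (sum-map-allFin n (λ w → 𝟙 ((toℕ u <ᵇ w) ∧ adjacent (toℕ u) w)))
    laterNeighbours : ∀ u w → w < n → T ((u <ᵇ w) ∧ adjacent u w) →
                      T (u <ᵇ w) × (w ≡ cycleSuc u ⊎ w ≡ cyclePred u ⊎ w ≡ p u)
    laterNeighbours u w w<n t = let u<w , adj = Equivalence.to T-∧ t in u<w , neighbours w<n adj

split-<2* : ∀ {K n} → 0 < n → n < 2 * K → ∃[ l ] ∃[ m ] (n ≡ l + suc m × l < K × m < K)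
split-<2* {suc K} {suc n} _ n< =
  let l , m , n≡l+m , l≤K , m≤K = ≤+⇒≡+ K K (s≤s⁻¹ (s≤s⁻¹ (≤-trans n< (≤-reflexive (double K)))))
  in l , m , trans (cong suc n≡l+m) (sym (+-suc l m)) , s≤s l≤K , s≤s m≤K
  where
  double : ∀ K → 2 * suc K ≡ suc (suc (K + K))
  double = solve-∀

n<2^suc⌊log₂n⌋ : ∀ n → n < 2 ^ suc ⌊log₂ n ⌋
n<2^suc⌊log₂n⌋ n with n <? 2 ^ suc ⌊log₂ n ⌋
... | yes n< = n<
... | no  n≮ = ⊥-elim (1+n≰n (subst (_≤ ⌊log₂ n ⌋) (⌊log₂[2^n]⌋≡n _) (⌊log₂⌋-mono-≤ (≮⇒≥ n≮))))

1≤⌊log₂n⌋ : ∀ {n} → 2 ≤ n → 1 ≤ ⌊log₂ n ⌋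
1≤⌊log₂n⌋ {n} 2≤n = subst (_≤ ⌊log₂ n ⌋) (⌊log₂[2^n]⌋≡n 1) (⌊log₂⌋-mono-≤ 2≤n)

edgeBound : ∀ {l m X E} → 8 * X ≤ 3 * l + 3 * m → E ≤ l + suc m + (1 + X) → E ≤ (11 * (l + suc m) + 6) / 8
edgeBound {l} {m} {X} {E} 8X≤ E≤ = begin
  E                          ≡⟨ m*n/n≡m E 8 ⟨
  E * 8 / 8                  ≤⟨ /-monoˡ-≤ 8 E*8≤ ⟩
  (11 * (l + suc m) + 6) / 8 ∎
  where
  open ≤-Reasoning
  E*8≤ : E * 8 ≤ 11 * (l + suc m) + 6
  E*8≤ = begin
    E * 8                                       ≤⟨ *-monoˡ-≤ 8 E≤ ⟩
    (l + suc m + (1 + X)) * 8                   ≡⟨ expand l m X ⟩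
    8 * X + (8 * l + 8 * m + 16)                ≤⟨ +-monoˡ-≤ _ 8X≤ ⟩
    3 * l + 3 * m + (8 * l + 8 * m + 16)        ≤⟨ m≤m+n _ 1 ⟩
    3 * l + 3 * m + (8 * l + 8 * m + 16) + 1    ≡⟨ collect l m ⟩
    11 * (l + suc m) + 6                        ∎
    where
    expand : ∀ l m X → (l + suc m + (1 + X)) * 8 ≡ 8 * X + (8 * l + 8 * m + 16)
    expand = solve-∀
    collect : ∀ l m → 3 * l + 3 * m + (8 * l + 8 * m + 16) + 1 ≡ 11 * (l + suc m) + 6
    collect = solve-∀

chordedCycle : ∀ {n K} → 3 ≤ n → n < 2 ^ suc K → 1 ≤ K → Σ (Graph n) λ G →
  Hamiltonian G × Diameter≤ G (2 * K) × MaxDegree≤ G 3 × numEdges G ≤ (11 * n + 6) / 8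
chordedCycle {n} {suc k} 3≤n n< (s≤s z≤n) with split-<2* {2 ^ suc k} (≤-trans (s≤s z≤n) 3≤n) n<
... | l , m , refl , l< , m< =
  graph , hamiltonian 3≤n , Diameter≤-centre centre near , degree≤3 , edgeBound sparse numEdges≤
  where
  B = chordedPath k l l<
  C = chordedPath k m m<
  open CycleWithChords (l + suc m) (hub l (chords B) (chords C))
                       (Involution-hub l m (involution B) (involution C))
  centre : Fin (l + suc m)
  centre = fromℕ< (m<m+n l z<s)
  near : ∀ v → Dist≤ graph centre v (suc k)
  near v = Reach≤⇒Dist≤ (subst (λ c → Reach≤ (hub l (chords B) (chords C)) (l + suc m) c (toℕ v) (suc k))
                               (sym (toℕ-fromℕ< (m<m+n l z<s)))
    (Ecc≤-hub l m (involution B) (eccentricity B) (eccentricity C) (toℕ v) (toℕ<n v)))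
  sparse : 8 * ups (hub l (chords B) (chords C)) (l + suc m) ≤ 3 * l + 3 * m
  sparse = begin
    8 * ups (hub l (chords B) (chords C)) (l + suc m)
      ≡⟨ cong (8 *_) (ups-hub l m (chords B) (chords C) (involution B)) ⟩
    8 * (downs (chords B) l + ups (chords C) m)
      ≡⟨ *-distribˡ-+ 8 (downs (chords B) l) (ups (chords C) m) ⟩
    8 * downs (chords B) l + 8 * ups (chords C) m
      ≤⟨ +-mono-≤ (Sparse⇒8*≤3* {L = l} (sparse-downs B)) (Sparse⇒8*≤3* {L = m} (sparse-ups C)) ⟩
    3 * l + 3 * m ∎
    where open ≤-Reasoning

mainTheorem3 : (n : ℕ) → 3 ≤ n → Σ (Graph n) λ G →
    Hamiltonian G
    × Diameter≤ G (2 * ⌊log₂ n ⌋)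
    × MaxDegree≤ G 3
    × numEdges G ≤ (11 * n + 6) / 8
mainTheorem3 n 3≤n = chordedCycle 3≤n (n<2^suc⌊log₂n⌋ n) (1≤⌊log₂n⌋ (≤-trans (n≤1+n 2) 3≤n))
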